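{- Let $\mathscr{C}$ be a class closed under inverse length increasing morphisms and $\mathscr{D}$ a quotient-closed Boolean algebra. Let $A$ be an alphabet and $L\in(\mathscr{C}\circ\mathscr{D})(A)$. Then there exists a finite index congruence $\mathbf{P}$ of $A^*$ which is a finite partition of $A^*$ into languages of $\mathscr{D}(A)$, such that $L$ is $\mathbf{P}$-liftable from $\mathscr{C}$.
   Context: A class $\mathscr{C}$ assigns to each alphabet $A$ a set $\mathscr{C}(A)$ of regular languages over $A$; it is closed under inverse length increasing morphisms if $\alpha^{ -1}(L)\in\mathscr{C}(A)$ whenever $L\in\mathscr{C}(B)$ and $\alpha:A^*\to B^*$ is a monoid morphism with $\alpha(a)\neq\varepsilon$ for all $a$. A quotient-closed Boolean algebra is a class in which each $\mathscr{D}(A)$ contains $\emptyset,A^*$ and is closed under finite unions, intersections, complement, and quotients $u^{ -1}L=\{v\mid uv\in L\}$, $Lu^{ -1}=\{v\mid vu\in L\}$. A finite partition $\mathbf{P}$ of $A^*$ is a finite index congruence if, writing $[u]_{\mathbf{P}}$ for the block containing $u$, $[u]_{\mathbf{P}}[v]_{\mathbf{P}}\subseteq[uv]_{\mathbf{P}}$ for all $u,v$. The tagging $\tau_{\mathbf{P}}:A^*\to(\mathbf{P}\times A)^*$ maps $a_1\cdots a_n$ to $b_1\cdots b_n$ with $b_i=([a_1\cdots a_{i-1}]_{\mathbf{P}},a_i)$, $\tau_{\mathbf{P}}(\varepsilon)=\varepsilon$. $L$ is $\mathbf{P}$-liftable from $\mathscr{C}$ if there are $L_P\in\mathscr{C}(\mathbf{P}\times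 A)$ with $L=\bigcup_{P\in\mathbf{P}}(\tau_{\mathbf{P}}^{ -1}(L_P)\cap P)$. $(\mathscr{C}\circ\mathscr{D})(A)$ is the set of $L\subseteq A^*$ that are $\mathbf{P}$-liftable from $\mathscr{C}$ for some finite partition $\mathbf{P}$ of $A^*$ into languages of $\mathscr{D}(A)$. -}

module Defs where

open import Data.Nat using (ℕ; _*_)
open import Data.Fin using (Fin; _≟_)
open import Data.Fin.Properties using (*↔×)
open import Data.Bool using (Bool; true; false; _∧_; _∨_; not; T)
open import Data.List using (List; []; _∷_; _++_; foldl; concatMap)
open import Data.Product using (Σ; ∃; ∃-syntax; _×_; _,_; proj₁; proj₂)
open import Data.Product.Function.NonDependent.Propositional using (_×-↔_)
open import Function using (_∘_)
open import Function.Bundles using (_↔_; _⇔_)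
open import Function.Properties.Inverse using (↔-trans; ↔-sym; ↔-refl)
open import Relation.Binary.PropositionalEquality using (_≡_; _≢_)
open import Relation.Nullary.Decidable using (⌊_⌋)

record Alphabet : Set₁ where
  field
    Carrier : Set
    size    : ℕ
    finite  : Carrier ↔ Fin size
open Alphabet public

-- Languages over A are subsets of A*, represented by their (decidable)
-- characteristic function.  All languages considered are regular, hence
-- decidable.
Lang : Alphabet → Set
Lang A = List (Carrier A) → Bool

Regular : (A : Alphabet) → Lang A → Set
Regular A L =
  Σ ℕ λ k → Σ (Fin k → Carrier A → Fin k) λ δ → Σ (Fin k) λ q₀ →
  Σ (Fin k → Bool) λ F → ∀ w → L w ≡ F (foldl δ q₀ w)

-- A class assigns to each alphabet a set of regular languages.
-- (Membership is extensional: it is a set of languages, not of programs.)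
record Class : Set₁ where
  field
    _∋_     : (A : Alphabet) → Lang A → Set
    regular : ∀ A L → A ∋ L → Regular A L
    ext     : ∀ A (L L′ : Lang A) → (∀ w → L w ≡ L′ w) → A ∋ L → A ∋ L′
open Class public

InvLengthIncClosed : Class → Set₁
InvLengthIncClosed 𝒞 =
  ∀ (A B : Alphabet) (α : Carrier A → List (Carrier B)) →
  (∀ a → α a ≢ []) →
  ∀ (L : Lang B) → _∋_ 𝒞 B L → _∋_ 𝒞 A (L ∘ concatMap α)

record QuotientClosedBA (𝒟 : Class) : Set₁ where
  field
    empty  : ∀ A → _∋_ 𝒟 A (λ _ → false)
    full   : ∀ A → _∋_ 𝒟 A (λ _ → true)
    union  : ∀ A L K → _∋_ 𝒟 A L → _∋_ 𝒟 A K → _∋_ 𝒟 A (λ w → L w ∨ K w)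
    inter  : ∀ A L K → _∋_ 𝒟 A L → _∋_ 𝒟 A K → _∋_ 𝒟 A (λ w → L w ∧ K w)
    compl  : ∀ A L → _∋_ 𝒟 A L → _∋_ 𝒟 A (λ w → not (L w))
    lquot  : ∀ A L (u : List (Carrier A)) → _∋_ 𝒟 A L → _∋_ 𝒟 A (λ v → L (u ++ v))
    rquot  : ∀ A L (u : List (Carrier A)) → _∋_ 𝒟 A L → _∋_ 𝒟 A (λ v → L (v ++ u))

record Partition (A : Alphabet) : Set where
  field
    k        : ℕ
    block    : List (Carrier A) → Fin k
    nonempty : ∀ (i : Fin k) → ∃[ w ] block w ≡ i
open Partition public

BlockLang : ∀ {A} (P : Partition A) → Fin (k P) → Lang A
BlockLang P i w = ⌊ block P w ≟ i ⌋

PartitionInto : (𝒟 : Class) (A : Alphabet) → Partition A → Set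
PartitionInto 𝒟 A P = ∀ i → _∋_ 𝒟 A (BlockLang P i)

IsCongruence : ∀ {A} → Partition A → Set
IsCongruence {A} P =
  ∀ (u v u′ v′ : List (Carrier A)) →
  block P u′ ≡ block P u → block P v′ ≡ block P v →
  block P (u′ ++ v′) ≡ block P (u ++ v)

TagAlphabet : (A : Alphabet) → Partition A → Alphabet
TagAlphabet A P = record
  { Carrier = Fin (k P) × Carrier A
  ; size    = k P * size A
  ; finite  = ↔-trans (↔-refl ×-↔ finite A) (↔-sym *↔×)
  }

-- Tagging: a₁⋯aₙ ↦ b₁⋯bₙ with bᵢ = ([a₁⋯aᵢ₋₁], aᵢ).
tagWith : ∀ {X : Set} {k} → (List X → Fin k) → List X → List (Fin k × X)
tagWith f []      = []
tagWith f (a ∷ w) = (f [] , a) ∷ tagWith (f ∘ (a ∷_)) w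

tag : ∀ {A} (P : Partition A) → List (Carrier A) → List (Fin (k P) × Carrier A)
tag P = tagWith (block P)

Liftable : (𝒞 : Class) (A : Alphabet) (P : Partition A) → Lang A → Set
Liftable 𝒞 A P L =
  Σ (Fin (k P) → Lang (TagAlphabet A P)) λ Ls →
    (∀ i → _∋_ 𝒞 (TagAlphabet A P) (Ls i)) ×
    (∀ w → T (L w) ⇔ (∃[ i ] (T (Ls i (tag P w)) × T (BlockLang P i w))))

InComp : (𝒞 𝒟 : Class) (A : Alphabet) → Lang A → Set
InComp 𝒞 𝒟 A L = ∃[ P ] (PartitionInto 𝒟 A P × Liftable 𝒞 A P L)

-- Every block B of P is regular, so the syntactic congruence ~ of the family of blocks
-- (u ~ v iff x u y ∈ B ⇔ x v y ∈ B for all blocks B and contexts x, y) has finite index,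
-- and a pumping argument on the transition profiles of automata for the blocks shows that
-- contexts of bounded length already determine it.  Hence each ~-class is a finite Boolean
-- combination of quotients x⁻¹ B y⁻¹, so lies in 𝒟.  The ~-classes form a congruence
-- refining P, and a language liftable over P is liftable over the finer partition: the
-- length-preserving relabelling of tags (j , a) ↦ (block of P containing the class j , a) turns the
-- tagging by ~ into the tagging by P.
module Submission where

open import Defs

open import Axiom.UniquenessOfIdentityProofs using (module Decidable⇒UIP)
open import Data.Bool using (Bool; true; false; not; T)
open import Data.Bool.Properties using () renaming (_≟_ to _≟ᵇ_)
open import Data.Empty using (⊥-elim)
open import Data.Fin using (Fin; zero; suc; toℕ; _≟_)
open import Data.Fin.Properties using (toℕ-injective; toℕ<n; pigeonhole)
open import Data.List
  using (List; []; _∷_; _++_; [_]; map; length; lookup; take; drop; foldl; concatMap;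
         allFin; cartesianProduct; cartesianProductWith; deduplicate)
open import Data.List.Properties
  using (∷-injective; ≡-dec; map-cong; foldl-++; ++-assoc; ++-identityʳ; length-++;
         length-take; length-drop; take++drop≡id)
open import Data.List.Membership.Propositional using (_∈_)
open import Data.List.Membership.Propositional.Properties
  using (∈-map⁺; ∈-map⁻; ∈-allFin; ∈-lookup; ∈-cartesianProduct⁺; ∈-cartesianProductWith⁺;
         ∈-deduplicate⁺; ∈-deduplicate⁻)
import Data.List.Membership.Setoid.Properties as SetoidMembership
open import Data.List.Relation.Unary.Any using (here; there; index)
open import Data.List.Relation.Unary.Any.Properties using (lookup-index)
open import Data.List.Relation.Unary.Unique.Propositional using (Unique)
open import Data.List.Relation.Unary.Unique.DecPropositional.Properties using (deduplicate-!)
open import Data.Nat using (ℕ; zero; suc; _+_; _∸_; _⊓_; _≤_; _<_; z≤n; s≤s; s≤s⁻¹; _≤?_)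
open import Data.Nat.Properties
  using (≤-refl; ≤-trans; <⇒≤; ≰⇒>; m⊓n≤m; ≤-<-trans; +-monoˡ-<; m+[n∸m]≡n; module ≤-Reasoning)
open import Data.Product using (∃-syntax; _×_; _,_; proj₁; proj₂; map₁)
open import Function using (_∘_)
open import Function.Bundles using (_⇔_; mk⇔; Equivalence; Inverse)
import Function.Properties.Equivalence as ⇔
open import Relation.Binary.Definitions using (DecidableEquality)
open import Relation.Binary.PropositionalEquality
  using (_≡_; refl; sym; trans; cong; cong₂; subst; subst₂; setoid; module ≡-Reasoning)
open import Relation.Nullary using (Dec; yes; no; does)
open import Relation.Nullary.Decidable using (⌊_⌋; isYes≗does; toWitness; fromWitness)

open Equivalence using (to; from)

map-≡⇒≡ : ∀ {X Y : Set} {f g : X → Y} {xs x} → map f xs ≡ map g xs → x ∈ xs → f x ≡ g x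
map-≡⇒≡ {xs = _ ∷ _} e (here refl) = proj₁ (∷-injective e)
map-≡⇒≡ {xs = _ ∷ _} e (there x∈) = map-≡⇒≡ (proj₂ (∷-injective e)) x∈

choices : ∀ {X : Set} → List (List X) → List (List X)
choices []         = [ [] ]
choices (xs ∷ xss) = cartesianProductWith _∷_ xs (choices xss)

map∈choices : ∀ {X Y : Set} {f : Y → X} {g : Y → List X} →
  (∀ y → f y ∈ g y) → ∀ ys → map f ys ∈ choices (map g ys)
map∈choices f∈g []       = here refl
map∈choices f∈g (y ∷ ys) = ∈-cartesianProductWith⁺ _∷_ (f∈g y) (map∈choices f∈g ys)

index-∈-lookup : ∀ {X : Set} (xs : List X) j → index (∈-lookup {xs = xs} j) ≡ j
index-∈-lookup (_ ∷ _)  zero    = refl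
index-∈-lookup (_ ∷ xs) (suc j) = cong suc (index-∈-lookup xs j)

index≡⇔≡lookup : ∀ {S : Set} → DecidableEquality S → ∀ {xs : List S} → Unique xs →
  ∀ {x} (x∈xs : x ∈ xs) j → index x∈xs ≡ j ⇔ x ≡ lookup xs j
index≡⇔≡lookup _≟ˢ_ {xs} xs! x∈xs j = mk⇔
  (λ { refl → lookup-index x∈xs })
  (λ { refl → trans (cong index (∈-irrelevant x∈xs (∈-lookup j))) (index-∈-lookup xs j) })
  where
  ∈-irrelevant = SetoidMembership.unique⇒irrelevant (setoid _) (Decidable⇒UIP.≡-irrelevant _≟ˢ_) xs!

⌊⌋-cong : ∀ {P Q : Set} (P? : Dec P) (Q? : Dec Q) → P ⇔ Q → ⌊ P? ⌋ ≡ ⌊ Q? ⌋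
⌊⌋-cong (yes _) (yes _) _   = refl
⌊⌋-cong (no _)  (no _)  _   = refl
⌊⌋-cong (yes p) (no ¬q) P⇔Q = ⊥-elim (¬q (to P⇔Q p))
⌊⌋-cong (no ¬p) (yes q) P⇔Q = ⊥-elim (¬p (from P⇔Q q))

module _ {X S : Set} (h : List X → S) (image : List S) (h∈image : ∀ w → h w ∈ image)
         (h-++ʳ : ∀ {u u′} w → h u ≡ h u′ → h (u ++ w) ≡ h (u′ ++ w)) where

  -- Two of the length image + 1 shortest prefixes of w have the same h-value; cut out the
  -- factor between them.
  pump-down : ∀ w → length image < length w → ∃[ w′ ] length w′ < length w × h w′ ≡ h w
  pump-down w N<∣w∣
    with i , j , i<j , same-index ←
      pigeonhole (s≤s ≤-refl) (λ (i : Fin (suc (length image))) → index (h∈image (take (toℕ i) w)))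
    = take (toℕ i) w ++ drop (toℕ j) w , shorter , same-h
    where
    j≤∣w∣ : toℕ j ≤ length w
    j≤∣w∣ = ≤-trans (s≤s⁻¹ (toℕ<n j)) (<⇒≤ N<∣w∣)

    shorter : length (take (toℕ i) w ++ drop (toℕ j) w) < length w
    shorter = begin-strict
      length (take (toℕ i) w ++ drop (toℕ j) w)
        ≡⟨ length-++ (take (toℕ i) w) ⟩
      length (take (toℕ i) w) + length (drop (toℕ j) w)
        ≡⟨ cong₂ _+_ (length-take (toℕ i) w) (length-drop (toℕ j) w) ⟩
      toℕ i ⊓ length w + (length w ∸ toℕ j)
        <⟨ +-monoˡ-< (length w ∸ toℕ j) (≤-<-trans (m⊓n≤m (toℕ i) (length w)) i<j) ⟩
      toℕ j + (length w ∸ toℕ j)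
        ≡⟨ m+[n∸m]≡n j≤∣w∣ ⟩
      length w ∎
      where open ≤-Reasoning

    same-h : h (take (toℕ i) w ++ drop (toℕ j) w) ≡ h w
    same-h = trans
      (h-++ʳ (drop (toℕ j) w)
        (SetoidMembership.index-injective (setoid _) (h∈image _) (h∈image _) same-index))
      (cong h (take++drop≡id (toℕ j) w))

  shorten : ∀ w → ∃[ w′ ] length w′ ≤ length image × h w′ ≡ h w
  shorten w = go (length w) w ≤-refl
    where
    go : ∀ n v → length v ≤ n → ∃[ v′ ] length v′ ≤ length image × h v′ ≡ h v
    go n v ∣v∣≤n with length v ≤? length image
    ... | yes ∣v∣≤N = v , ∣v∣≤N , refl
    go zero v ∣v∣≤0 | no ∣v∣≰N = ⊥-elim (∣v∣≰N (≤-trans ∣v∣≤0 z≤n))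
    go (suc n) v ∣v∣≤1+n | no ∣v∣≰N
      with v′ , ∣v′∣<∣v∣ , hv′ ← pump-down v (≰⇒> ∣v∣≰N)
      with v″ , ∣v″∣≤N , hv″ ← go n v′ (s≤s⁻¹ (≤-trans ∣v′∣<∣v∣ ∣v∣≤1+n))
      = v″ , ∣v″∣≤N , trans hv″ hv′

words≤ : ∀ {X : Set} → List X → ℕ → List (List X)
words≤ xs zero    = [ [] ]
words≤ xs (suc n) = [] ∷ cartesianProductWith _∷_ xs (words≤ xs n)

∈-words≤ : ∀ {X : Set} {xs : List X} → (∀ x → x ∈ xs) → ∀ n {w} → length w ≤ n → w ∈ words≤ xs n
∈-words≤ x∈xs zero    {[]}    _         = here refl
∈-words≤ x∈xs (suc n) {[]}    _         = here refl
∈-words≤ x∈xs (suc n) {x ∷ w} (s≤s ∣w∣≤n) =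
  there (∈-cartesianProductWith⁺ _∷_ (x∈xs x) (∈-words≤ x∈xs n ∣w∣≤n))

letters : (A : Alphabet) → List (Carrier A)
letters A = map (Inverse.from (finite A)) (allFin (size A))

∈-letters : ∀ A a → a ∈ letters A
∈-letters A a = subst (_∈ letters A) (Inverse.strictlyInverseʳ (finite A) a)
  (∈-map⁺ (Inverse.from (finite A)) (∈-allFin (Inverse.to (finite A) a)))

module TransitionProfile {A : Alphabet} {K : ℕ} (L : Fin K → Lang A) (dfa : ∀ i → Regular A (L i)) where

  states : Fin K → ℕ
  states i = proj₁ (dfa i)

  δ : ∀ i → Fin (states i) → Carrier A → Fin (states i)
  δ i = proj₁ (proj₂ (dfa i))

  initial : ∀ i → Fin (states i)
  initial i = proj₁ (proj₂ (proj₂ (dfa i)))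

  final : ∀ i → Fin (states i) → Bool
  final i = proj₁ (proj₂ (proj₂ (proj₂ (dfa i))))

  run : ∀ i → Fin (states i) → List (Carrier A) → Fin (states i)
  run i = foldl (δ i)

  recognises : ∀ i w → L i w ≡ final i (run i (initial i) w)
  recognises i = proj₂ (proj₂ (proj₂ (proj₂ (dfa i))))

  -- The state maps of all K automata, with states coded by toℕ so that they share one type.
  profile : List (Carrier A) → List (List ℕ)
  profile w = map (λ i → map (λ q → toℕ (run i q w)) (allFin (states i))) (allFin K)

  profiles : List (List (List ℕ))
  profiles = choices (map (λ i → choices (map (λ _ → map toℕ (allFin (states i))) (allFin (states i)))) (allFin K))

  profile∈profiles : ∀ w → profile w ∈ profiles
  profile∈profiles w = map∈choices
    (λ i → map∈choices (λ q → ∈-map⁺ toℕ (∈-allFin (run i q w))) (allFin (states i))) (allFin K)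

  profile≡⇔run≡ : ∀ {u v} → profile u ≡ profile v ⇔ (∀ i q → run i q u ≡ run i q v)
  profile≡⇔run≡ = mk⇔
    (λ e i q → toℕ-injective (map-≡⇒≡ (map-≡⇒≡ e (∈-allFin i)) (∈-allFin q)))
    (λ e → map-cong (λ i → map-cong (λ q → cong toℕ (e i q)) (allFin (states i))) (allFin K))

  profile-++ : ∀ {u u′ v v′} → profile u ≡ profile u′ → profile v ≡ profile v′ →
    profile (u ++ v) ≡ profile (u′ ++ v′)
  profile-++ {u} {u′} {v} {v′} eu ev = from (profile≡⇔run≡ {u ++ v} {u′ ++ v′}) λ i q → begin
    run i q (u ++ v)      ≡⟨ foldl-++ (δ i) q u v ⟩
    run i (run i q u) v   ≡⟨ cong (λ q′ → run i q′ v) (to (profile≡⇔run≡ {u} {u′}) eu i q) ⟩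
    run i (run i q u′) v  ≡⟨ to (profile≡⇔run≡ {v} {v′}) ev i (run i q u′) ⟩
    run i (run i q u′) v′ ≡⟨ foldl-++ (δ i) q u′ v′ ⟨
    run i q (u′ ++ v′)    ∎
    where open ≡-Reasoning

  profile≡⇒L≡ : ∀ u v → profile u ≡ profile v → ∀ i → L i u ≡ L i v
  profile≡⇒L≡ u v e i = trans (recognises i u)
    (trans (cong (final i) (to (profile≡⇔run≡ {u} {v}) e i (initial i))) (sym (recognises i v)))

module _ {𝒟 : Class} (BA : QuotientClosedBA 𝒟) (A : Alphabet) where
  open QuotientClosedBA BA

  does-≟-∈ : ∀ {L} b → _∋_ 𝒟 A L → _∋_ 𝒟 A (λ w → does (L w ≟ᵇ b))
  does-≟-∈ {L} true  L∈𝒟 = ext 𝒟 A _ _ (λ w → does-≟-true (L w)) L∈𝒟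
    where
    does-≟-true : ∀ b → b ≡ does (b ≟ᵇ true)
    does-≟-true true  = refl
    does-≟-true false = refl
  does-≟-∈ {L} false L∈𝒟 = ext 𝒟 A _ _ (λ w → does-≟-false (L w)) (compl A L L∈𝒟)
    where
    does-≟-false : ∀ b → not b ≡ does (b ≟ᵇ false)
    does-≟-false true  = refl
    does-≟-false false = refl

  signature-fibre-∈ : ∀ {I : Set} (lang : I → Lang A) → (∀ τ → _∋_ 𝒟 A (lang τ)) →
    ∀ τs s → _∋_ 𝒟 A (λ w → does (≡-dec _≟ᵇ_ (map (λ τ → lang τ w) τs) s))
  signature-fibre-∈ lang lang∈𝒟 []       []      = full A
  signature-fibre-∈ lang lang∈𝒟 []       (_ ∷ _) = empty A
  signature-fibre-∈ lang lang∈𝒟 (_ ∷ _)  []      = empty A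
  signature-fibre-∈ lang lang∈𝒟 (τ ∷ τs) (b ∷ s) =
    inter A _ _ (does-≟-∈ b (lang∈𝒟 τ)) (signature-fibre-∈ lang lang∈𝒟 τs s)

  two-sided-quotient-∈ : ∀ {L} x y → _∋_ 𝒟 A L → _∋_ 𝒟 A (λ v → L (x ++ v ++ y))
  two-sided-quotient-∈ {L} x y L∈𝒟 =
    ext 𝒟 A _ _ (λ v → cong L (++-assoc x v y)) (lquot A _ x (rquot A L y L∈𝒟))

module KernelPartition {A : Alphabet} {S : Set} (_≟ˢ_ : DecidableEquality S)
  (σ : List (Carrier A) → S) (ws : List (List (Carrier A)))
  (covered : ∀ v → ∃[ w ] w ∈ ws × σ w ≡ σ v) where

  classes : List S
  classes = deduplicate _≟ˢ_ (map σ ws)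

  σ∈classes : ∀ v → σ v ∈ classes
  σ∈classes v with w , w∈ws , σw≡σv ← covered v =
    subst (_∈ classes) σw≡σv (∈-deduplicate⁺ _≟ˢ_ (∈-map⁺ σ w∈ws))

  class : List (Carrier A) → Fin (length classes)
  class v = index (σ∈classes v)

  class≡⇔ : ∀ v j → class v ≡ j ⇔ σ v ≡ lookup classes j
  class≡⇔ v = index≡⇔≡lookup _≟ˢ_ (deduplicate-! _≟ˢ_ (map σ ws)) (σ∈classes v)

  class-≡⇔ : ∀ {u v} → class u ≡ class v ⇔ σ u ≡ σ v
  class-≡⇔ {u} {v} = ⇔.trans (class≡⇔ u (class v)) (mk⇔ (λ e → trans e (sym σv)) (λ e → trans e σv))
    where
    σv : σ v ≡ lookup classes (class v)
    σv = to (class≡⇔ v (class v)) refl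

  representative : Fin (length classes) → List (Carrier A)
  representative j = proj₁ (∈-map⁻ σ (∈-deduplicate⁻ _≟ˢ_ (map σ ws) (∈-lookup j)))

  class-representative : ∀ j → class (representative j) ≡ j
  class-representative j = from (class≡⇔ (representative j) j)
    (sym (proj₂ (proj₂ (∈-map⁻ σ (∈-deduplicate⁻ _≟ˢ_ (map σ ws) (∈-lookup j))))))

  partition : Partition A
  partition = record
    { k        = length classes
    ; block    = class
    ; nonempty = λ j → representative j , class-representative j
    }

  blockLang≡ : ∀ j v → BlockLang partition j v ≡ does (σ v ≟ˢ lookup classes j)
  blockLang≡ j v = trans (⌊⌋-cong (class v ≟ j) (σ v ≟ˢ lookup classes j) (class≡⇔ v j))
    (isYes≗does (σ v ≟ˢ lookup classes j))

∃-block⇔ : ∀ {A} (P : Partition A) (M : Fin (k P) → Bool) w →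
  (∃[ i ] T (M i) × T (BlockLang P i w)) ⇔ T (M (block P w))
∃-block⇔ P M w = mk⇔
  (λ (i , Mi , w∈i) → subst (T ∘ M) (sym (toWitness w∈i)) Mi)
  (λ Mw → block P w , Mw , fromWitness refl)

liftable-refine : ∀ {𝒞 A L} → InvLengthIncClosed 𝒞 → (P Q : Partition A) (f : Fin (k Q) → Fin (k P)) →
  (∀ w → block P w ≡ f (block Q w)) → Liftable 𝒞 A P L → Liftable 𝒞 A Q L
liftable-refine {𝒞} {A} closed P Q f refines (Ls , Ls∈𝒞 , L⇔) =
  (λ j → Ls (f j) ∘ concatMap relabel) ,
  (λ j → closed (TagAlphabet A Q) (TagAlphabet A P) relabel (λ _ ()) (Ls (f j)) (Ls∈𝒞 (f j))) ,
  λ w → ⇔.trans (L⇔ w) (⇔.trans (∃-block⇔ P (λ i → Ls i (tag P w)) w)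
          (⇔.trans (mk⇔ (subst T (same-lift w)) (subst T (sym (same-lift w))))
                   (⇔.sym (∃-block⇔ Q (λ j → Ls (f j) (concatMap relabel (tag Q w))) w))))
  where
  relabel : Fin (k Q) × Carrier A → List (Fin (k P) × Carrier A)
  relabel b = [ map₁ f b ]

  relabel-tagWith : ∀ (bP : List (Carrier A) → Fin (k P)) (bQ : List (Carrier A) → Fin (k Q)) →
    (∀ w → bP w ≡ f (bQ w)) → ∀ w → concatMap relabel (tagWith bQ w) ≡ tagWith bP w
  relabel-tagWith bP bQ bP≡ []      = refl
  relabel-tagWith bP bQ bP≡ (a ∷ w) = cong₂ _∷_ (cong (_, a) (sym (bP≡ [])))
    (relabel-tagWith (bP ∘ (a ∷_)) (bQ ∘ (a ∷_)) (bP≡ ∘ (a ∷_)) w)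

  same-lift : ∀ w → Ls (block P w) (tag P w) ≡ Ls (f (block Q w)) (concatMap relabel (tag Q w))
  same-lift w = cong₂ Ls (refines w) (sym (relabel-tagWith (block P) (block Q) refines w))

Syntactic : ∀ {A} → Partition A → List (Carrier A) → List (Carrier A) → Set
Syntactic P u v = ∀ i x y → BlockLang P i (x ++ u ++ y) ≡ BlockLang P i (x ++ v ++ y)

syntactic-++ : ∀ {A} (P : Partition A) {u u′ v v′} →
  Syntactic P u u′ → Syntactic P v v′ → Syntactic P (u ++ v) (u′ ++ v′)
syntactic-++ P {u} {u′} {v} {v′} u~u′ v~v′ i x y = begin
  B (x ++ (u ++ v) ++ y)    ≡⟨ cong (λ z → B (x ++ z)) (++-assoc u v y) ⟩
  B (x ++ u ++ v ++ y)      ≡⟨ u~u′ i x (v ++ y) ⟩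
  B (x ++ u′ ++ v ++ y)     ≡⟨ cong B (++-assoc x u′ (v ++ y)) ⟨
  B ((x ++ u′) ++ v ++ y)   ≡⟨ v~v′ i (x ++ u′) y ⟩
  B ((x ++ u′) ++ v′ ++ y)  ≡⟨ cong B (++-assoc x u′ (v′ ++ y)) ⟩
  B (x ++ u′ ++ v′ ++ y)    ≡⟨ cong (λ z → B (x ++ z)) (++-assoc u′ v′ y) ⟨
  B (x ++ (u′ ++ v′) ++ y)  ∎
  where
  open ≡-Reasoning
  B = BlockLang P i

syntactic⇒block≡ : ∀ {A} (P : Partition A) {u v} → Syntactic P u v → block P u ≡ block P v
syntactic⇒block≡ P {u} {v} u~v = sym (toWitness (subst T same (fromWitness refl)))
  where
  same : BlockLang P (block P u) u ≡ BlockLang P (block P u) v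
  same = subst₂ (λ u′ v′ → BlockLang P (block P u) u′ ≡ BlockLang P (block P u) v′)
    (++-identityʳ u) (++-identityʳ v) (u~v (block P u) [] [])

module SyntacticPartition {𝒟 : Class} (BA : QuotientClosedBA 𝒟) {A : Alphabet}
  (P : Partition A) (P⊆𝒟 : PartitionInto 𝒟 A P) where

  open TransitionProfile {A = A} (BlockLang P) (λ i → regular 𝒟 A (BlockLang P i) (P⊆𝒟 i))

  contexts : List (List (Carrier A))
  contexts = words≤ (letters A) (length profiles)

  short-context : ∀ w → ∃[ x ] x ∈ contexts × profile x ≡ profile w
  short-context w with x , ∣x∣≤N , same ← shorten profile profiles profile∈profiles (λ {u} {u′} w e → profile-++ {u} {u′} {w} {w} e refl) w =
    x , ∈-words≤ (∈-letters A) (length profiles) ∣x∣≤N , same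

  Test : Set
  Test = Fin (k P) × List (Carrier A) × List (Carrier A)

  tests : List Test
  tests = cartesianProduct (allFin (k P)) (cartesianProduct contexts contexts)

  test : Test → Lang A
  test (i , x , y) v = BlockLang P i (x ++ v ++ y)

  signature : List (Carrier A) → List Bool
  signature v = map (λ τ → test τ v) tests

  profile≡⇒syntactic : ∀ {u v} → profile u ≡ profile v → Syntactic P u v
  profile≡⇒syntactic {u} {v} e i x y =
    profile≡⇒L≡ (x ++ u ++ y) (x ++ v ++ y) (profile-++ {x} {x} refl (profile-++ {u} {v} {y} {y} e refl)) i

  syntactic⇒signature≡ : ∀ {u v} → Syntactic P u v → signature u ≡ signature v
  syntactic⇒signature≡ u~v = map-cong (λ (i , x , y) → u~v i x y) tests

  -- Contexts may be replaced by short ones with the same profile, and those are tested.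
  signature≡⇒syntactic : ∀ {u v} → signature u ≡ signature v → Syntactic P u v
  signature≡⇒syntactic {u} {v} e i x y
    with x′ , x′∈ , x′≡x ← short-context x
       | y′ , y′∈ , y′≡y ← short-context y = begin
    B (x ++ u ++ y)    ≡⟨ profile≡⇒L≡ (x ++ u ++ y) (x′ ++ u ++ y′) (profile-++ {x} {x′} (sym x′≡x) (profile-++ {u} {u} {y} {y′} refl (sym y′≡y))) i ⟩
    B (x′ ++ u ++ y′)  ≡⟨ map-≡⇒≡ e (∈-cartesianProduct⁺ (∈-allFin i) (∈-cartesianProduct⁺ x′∈ y′∈)) ⟩
    B (x′ ++ v ++ y′)  ≡⟨ profile≡⇒L≡ (x′ ++ v ++ y′) (x ++ v ++ y) (profile-++ {x′} {x} x′≡x (profile-++ {v} {v} {y′} {y} refl y′≡y)) i ⟩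
    B (x ++ v ++ y)    ∎
    where
    open ≡-Reasoning
    B = BlockLang P i

  signature-covered : ∀ v → ∃[ x ] x ∈ contexts × signature x ≡ signature v
  signature-covered v with x , x∈ , x≡v ← short-context v =
    x , x∈ , syntactic⇒signature≡ (profile≡⇒syntactic x≡v)

  open KernelPartition {A = A} (≡-dec _≟ᵇ_) signature contexts signature-covered public

  partition-congruence : IsCongruence partition
  partition-congruence u v u′ v′ u′≡u v′≡v = from class-≡⇔ (syntactic⇒signature≡
    (syntactic-++ P (signature≡⇒syntactic (to class-≡⇔ u′≡u)) (signature≡⇒syntactic (to class-≡⇔ v′≡v))))

  partition-into-𝒟 : PartitionInto 𝒟 A partition
  partition-into-𝒟 j = ext 𝒟 A _ _ (λ v → sym (blockLang≡ j v))
    (signature-fibre-∈ BA A test (λ (i , x , y) → two-sided-quotient-∈ BA A x y (P⊆𝒟 i)) tests _)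

  partition-refines : ∀ w → block P w ≡ block P (representative (class w))
  partition-refines w = syntactic⇒block≡ P
    (signature≡⇒syntactic (sym (to class-≡⇔ (class-representative (class w)))))

lemma4p7 : (𝒞 𝒟 : Class) → InvLengthIncClosed 𝒞 → QuotientClosedBA 𝒟 →
    (A : Alphabet) (L : Lang A) → InComp 𝒞 𝒟 A L →
    ∃[ P ] (IsCongruence P × PartitionInto 𝒟 A P × Liftable 𝒞 A P L)
lemma4p7 𝒞 𝒟 closed BA A L (P , P⊆𝒟 , L-liftable) =
  partition , partition-congruence , partition-into-𝒟 ,
  liftable-refine {𝒞} closed P partition (block P ∘ representative) partition-refines L-liftable
  where open SyntacticPartition BA P P⊆𝒟
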